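{- Let $p>3$ be a prime, $t\in \{1,3,p,3p\}$, and $1\leqslant r\leqslant 3p-1$ with $\gcd(r,3p)=1$. Then \[\Lambda(1,r,t)=\begin{cases} \emptyset & \text{if } r\equiv 1\pmod 3,\\ \{\ell\in \Delta(|r|_p)\mid \ell \text{ is odd}\} & \text{if } r\equiv 2\pmod 3. \end{cases}\]
   Context: $|r|_m$ is the multiplicative order of $r$ modulo $m$. $S_k(x)=1+x+\cdots+x^{k-1}$ for $k\ge1$, $S_0(x)=0$; for a positive integer $m$ with $\gcd(r,m)=1$, $\kappa(m,r,t)=\dfrac{m|r|_m}{\gcd(m,\ tS_{|r|_m}(r))}$. For a divisor $d$ of $3p$, $\Lambda(d,r,t)=\{\ell>0\mid \ell \text{ divides } \frac{|r|_{3p}}{\gcd(\kappa(d,r,t),|r|_{3p})} \text{ and } \gcd(r^{\ell\kappa(d,r,t)}-1,3p)=d\}$. For a positive integer $m$, $\Delta(m)=\{\ell\in\mathbb{Z}\mid 0<\ell<m,\ \ell\mid m\}$ (proper positive divisors). -}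

module Defs where

open import Data.Nat using (ℕ; zero; suc; _+_; _*_; _∸_; _^_; _<_; _%_; _/_)
open import Data.Nat.Divisibility using (_∣_; _∣?_)
open import Data.Nat.GCD using (gcd)
open import Data.Product using (_×_)
open import Relation.Nullary using (yes; no)
open import Relation.Binary.PropositionalEquality using (_≡_)

-- Total natural-number division: a ÷ 0 = 0, otherwise the usual floor division.
-- (Only ever applied to nonzero divisors in the statement when gcd(r,3p)=1.)
_÷_ : ℕ → ℕ → ℕ
a ÷ zero    = 0
a ÷ (suc b) = a / suc b

ordSearch : ℕ → ℕ → ℕ → ℕ → ℕ
ordSearch m r zero    k = 0
ordSearch m r (suc n) k with m ∣? (r ^ k ∸ 1)
... | yes _ = k
... | no  _ = ordSearch m r n (suc k)

-- |r|_m : multiplicative order of r modulo m, i.e. the least k ≥ 1 with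
-- r^k ≡ 1 (mod m).  When gcd(r,m)=1 and m ≥ 1 this order is ≤ m, so the
-- search over k = 1, …, m finds it.
ord : ℕ → ℕ → ℕ
ord m r = ordSearch m r m 1

S : ℕ → ℕ → ℕ
S zero    x = 0
S (suc k) x = S k x + x ^ k

κ : ℕ → ℕ → ℕ → ℕ
κ m r t = (m * ord m r) ÷ gcd m (t * S (ord m r) r)

Λ : ℕ → ℕ → ℕ → ℕ → ℕ → Set
Λ p d r t ℓ =
  (0 < ℓ)
  × (ℓ ∣ (ord (3 * p) r ÷ gcd (κ d r t) (ord (3 * p) r)))
  × (gcd (r ^ (ℓ * κ d r t) ∸ 1) (3 * p) ≡ d)

Δ : ℕ → ℕ → Set
Δ m ℓ = (0 < ℓ) × (ℓ < m) × (ℓ ∣ m)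

-- Since κ(1,r,t) = 1, Λ(1,r,t) consists of the divisors ℓ of |r|_{3p} with r^ℓ ≢ 1 modulo
-- both 3 and p.  If r ≡ 1 (mod 3) every power of r is ≡ 1 (mod 3), so there are none.  If
-- r ≡ 2 (mod 3) then r has order 2 modulo 3, so r^ℓ ≢ 1 (mod 3) exactly for odd ℓ; moreover
-- |r|_p ∣ |r|_{3p} ∣ 2|r|_p, so the odd divisors of |r|_{3p} are those of |r|_p, and
-- r^ℓ ≢ 1 (mod p) excludes exactly ℓ = |r|_p among them.
module Submission where

open import Defs
open import Data.Nat using (ℕ; zero; suc; _+_; _*_; _∸_; _^_; _≤_; _<_; _%_; _/_; z<s; s≤s; NonZero; >-nonZero; >-nonZero⁻¹)
open import Data.Nat.Properties
open import Data.Nat.Divisibility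
open import Data.Nat.DivMod
open import Data.Nat.GCD using (gcd; gcd-zeroˡ)
open import Data.Nat.Primality using (Prime; prime⇒irreducible; prime⇒nonZero; ¬prime[1]; prime[2]; prime?)
open import Data.Nat.Coprimality as Coprime using (Coprime; coprime-divisor; gcd≡1⇒coprime; coprime⇒gcd≡1; prime⇒coprime)
open import Data.Nat.Tactic.RingSolver using (solve-∀)
open import Data.Fin using (toℕ; fromℕ<)
open import Data.Fin.Properties using (pigeonhole; toℕ-fromℕ<; toℕ≤pred[n])
open import Data.Product using (_×_; _,_; proj₂; ∃-syntax)
open import Data.Sum using (_⊎_; [_,_]′)
open import Data.Empty using (⊥)
open import Function using (_∘_; id)
open import Function.Bundles using (_⇔_; mk⇔; Equivalence)
open import Function.Construct.Composition using (_⇔-∘_)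
open import Relation.Nullary using (¬_; yes; no; contradiction)
open import Relation.Nullary.Decidable using (from-yes)
open import Relation.Binary.PropositionalEquality

open Equivalence using (to; from)

m*n∸1≡m*[n∸1]+[m∸1] : ∀ m n .{{_ : NonZero n}} → m * n ∸ 1 ≡ m * (n ∸ 1) + (m ∸ 1)
m*n∸1≡m*[n∸1]+[m∸1] zero    (suc n) = refl
m*n∸1≡m*[n∸1]+[m∸1] (suc m) (suc n) = identity m n
  where
  identity : ∀ m n → n + m * suc n ≡ suc m * n + m
  identity = solve-∀

m^[n+o]∸1≡m^o*[m^n∸1]+[m^o∸1] : ∀ m .{{_ : NonZero m}} n o →
  m ^ (n + o) ∸ 1 ≡ m ^ o * (m ^ n ∸ 1) + (m ^ o ∸ 1)
m^[n+o]∸1≡m^o*[m^n∸1]+[m^o∸1] m n o = begin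
  m ^ (n + o) ∸ 1                ≡⟨ cong (_∸ 1) (^-distribˡ-+-* m n o) ⟩
  m ^ n * m ^ o ∸ 1              ≡⟨ cong (_∸ 1) (*-comm (m ^ n) (m ^ o)) ⟩
  m ^ o * m ^ n ∸ 1              ≡⟨ m*n∸1≡m*[n∸1]+[m∸1] (m ^ o) (m ^ n) {{m^n≢0 m n}} ⟩
  m ^ o * (m ^ n ∸ 1) + (m ^ o ∸ 1) ∎
  where open ≡-Reasoning

m^[n+o]∸m^n≡m^n*[m^o∸1] : ∀ m n o → m ^ (n + o) ∸ m ^ n ≡ m ^ n * (m ^ o ∸ 1)
m^[n+o]∸m^n≡m^n*[m^o∸1] m n o = begin
  m ^ (n + o) ∸ m ^ n         ≡⟨ cong₂ _∸_ (^-distribˡ-+-* m n o) (sym (*-identityʳ (m ^ n))) ⟩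
  m ^ n * m ^ o ∸ m ^ n * 1   ≡⟨ sym (*-distribˡ-∸ (m ^ n) (m ^ o) 1) ⟩
  m ^ n * (m ^ o ∸ 1)         ∎
  where open ≡-Reasoning

%≡⇒∣∸ : ∀ m n d .{{_ : NonZero d}} → m % d ≡ n % d → d ∣ m ∸ n
%≡⇒∣∸ m n d m%d≡n%d = divides (m / d ∸ n / d) (begin
  m ∸ n                                     ≡⟨ cong₂ _∸_ (m≡m%n+[m/n]*n m d) (m≡m%n+[m/n]*n n d) ⟩
  (m % d + (m / d) * d) ∸ (n % d + (n / d) * d) ≡⟨ cong (λ x → (x + (m / d) * d) ∸ (n % d + (n / d) * d)) m%d≡n%d ⟩
  (n % d + (m / d) * d) ∸ (n % d + (n / d) * d) ≡⟨ [m+n]∸[m+o]≡n∸o (n % d) _ _ ⟩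
  (m / d) * d ∸ (n / d) * d                 ≡⟨ sym (*-distribʳ-∸ d (m / d) (n / d)) ⟩
  (m / d ∸ n / d) * d                       ∎)
  where open ≡-Reasoning

∣∸⇒%≡ : ∀ m n d .{{_ : NonZero d}} → n ≤ m → d ∣ m ∸ n → m % d ≡ n % d
∣∸⇒%≡ m n d n≤m d∣m∸n = begin
  m % d             ≡⟨ cong (_% d) (sym (m+[n∸m]≡n n≤m)) ⟩
  (n + (m ∸ n)) % d ≡⟨ %-remove-+ʳ n d∣m∸n ⟩
  n % d             ∎
  where open ≡-Reasoning

coprime-divisor-^ : ∀ {m r n} k → Coprime m r → m ∣ r ^ k * n → m ∣ n
coprime-divisor-^ {m} {n = n} zero    _ m∣n = subst (m ∣_) (+-identityʳ n) m∣n
coprime-divisor-^ {m} {r} {n} (suc k) c m∣r^[1+k]*n =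
  coprime-divisor-^ k c (coprime-divisor c (subst (m ∣_) (*-assoc r (r ^ k) n) m∣r^[1+k]*n))

coprime-*⇔ : ∀ {x m n} → Coprime x (m * n) ⇔ (Coprime x m × Coprime x n)
coprime-*⇔ {x} {m} {n} = mk⇔
  (λ c → (λ {_} (i∣x , i∣m) → c (i∣x , ∣m⇒∣m*n n i∣m)) , (λ {_} (i∣x , i∣n) → c (i∣x , ∣n⇒∣m*n m i∣n)))
  (λ (cm , cn) {_} (i∣x , i∣mn) →
    cn (i∣x , coprime-divisor (λ {_} (j∣i , j∣m) → cm (∣-trans j∣i i∣x , j∣m)) i∣mn))

coprime⇔∤ : ∀ {p x} → Prime p → Coprime x p ⇔ (¬ p ∣ x)
coprime⇔∤ {p} {x} pp = mk⇔
  (λ c p∣x → ¬prime[1] (subst Prime (c (p∣x , ∣-refl)) pp))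
  (λ p∤x {_} (i∣x , i∣p) → [ id , (λ i≡p → contradiction (subst (_∣ x) i≡p i∣x) p∤x) ]′ (prime⇒irreducible pp i∣p))

coprime-*-∣ : ∀ {m n x} → Coprime m n → m ∣ x → n ∣ x → m * n ∣ x
coprime-*-∣ {m} {n} c (divides q refl) n∣q*m =
  subst (m * n ∣_) (*-comm m q) (*-monoʳ-∣ m (coprime-divisor (Coprime.sym c) (subst (n ∣_) (*-comm q m) n∣q*m)))

¬2∣⇔%2≡1 : ∀ {n} → (¬ 2 ∣ n) ⇔ (n % 2 ≡ 1)
¬2∣⇔%2≡1 {n} = mk⇔ to′ (λ n%2≡1 2∣n → 0≢1+n (trans (sym (n∣m⇒m%n≡0 n 2 2∣n)) n%2≡1))
  where
  to′ : ¬ 2 ∣ n → n % 2 ≡ 1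
  to′ 2∤n with n % 2 in eq
  ... | zero = contradiction (m%n≡0⇒n∣m n 2 eq) 2∤n
  ... | suc zero = refl
  ... | suc (suc _) = contradiction (subst (_< 2) eq (m%n<n n 2)) λ { (s≤s (s≤s ())) }

-- For r = 0 truncated subtraction makes r ^ k ≡1[mod m ] hold for every k > 0,
-- hence the NonZero r hypotheses below.
infix 4 _^_≡1[mod_]
_^_≡1[mod_] : ℕ → ℕ → ℕ → Set
r ^ k ≡1[mod m ] = m ∣ r ^ k ∸ 1

module _ {m r : ℕ} .{{_ : NonZero r}} where

  ^≡1-+ : ∀ a b → r ^ a ≡1[mod m ] → (r ^ (a + b) ≡1[mod m ]) ⇔ (r ^ b ≡1[mod m ])
  ^≡1-+ a b m∣r^a∸1 = mk⇔
    (λ m∣r^[a+b]∸1 → ∣m+n∣m⇒∣n (subst (m ∣_) (split a b) m∣r^[a+b]∸1) (∣n⇒∣m*n (r ^ b) m∣r^a∸1))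
    (λ m∣r^b∸1 → subst (m ∣_) (sym (split a b)) (∣m∣n⇒∣m+n (∣n⇒∣m*n (r ^ b) m∣r^a∸1) m∣r^b∸1))
    where split = m^[n+o]∸1≡m^o*[m^n∸1]+[m^o∸1] r

  ^≡1-* : ∀ {o} → r ^ o ≡1[mod m ] → ∀ q → r ^ (q * o) ≡1[mod m ]
  ^≡1-* _    zero    = m ∣0
  ^≡1-* {o} r^o≡1 (suc q) = from (^≡1-+ o (q * o) r^o≡1) (^≡1-* r^o≡1 q)

record IsOrder (m r o : ℕ) : Set where
  field
    {{nonZero}}  : NonZero o
    root         : r ^ o ≡1[mod m ]
    minimal      : ∀ {k} → 0 < k → k < o → ¬ r ^ k ≡1[mod m ]

open IsOrder

^≡1⇔order∣ : ∀ {m r o k} .{{_ : NonZero r}} → IsOrder m r o → (r ^ k ≡1[mod m ]) ⇔ (o ∣ k)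
^≡1⇔order∣ {m} {r} {o} {k} ord = mk⇔ to′ λ { (divides q k≡q*o) →
  subst (λ i → r ^ i ≡1[mod m ]) (sym k≡q*o) (^≡1-* (root ord) q) }
  where
  instance _ = nonZero ord
  to′ : r ^ k ≡1[mod m ] → o ∣ k
  to′ r^k≡1 with k % o in k%o≡rem
  ... | zero  = m%n≡0⇒n∣m k o k%o≡rem
  ... | suc c = contradiction r^c+1≡1 (minimal ord z<s (subst (_< o) k%o≡rem (m%n<n k o)))
    where
    k≡[k/o]*o+c+1 : k ≡ (k / o) * o + suc c
    k≡[k/o]*o+c+1 = trans (m≡m%n+[m/n]*n k o) (trans (cong (_+ (k / o) * o) k%o≡rem) (+-comm (suc c) _))
    r^c+1≡1 : r ^ suc c ≡1[mod m ]
    r^c+1≡1 = to (^≡1-+ ((k / o) * o) (suc c) (^≡1-* (root ord) (k / o)))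
                 (subst (λ i → r ^ i ≡1[mod m ]) k≡[k/o]*o+c+1 r^k≡1)

∣⇒order∣order : ∀ {d m r o O} .{{_ : NonZero r}} → d ∣ m → IsOrder d r o → IsOrder m r O → o ∣ O
∣⇒order∣order d∣m ord-d ord-m = to (^≡1⇔order∣ ord-d) (∣-trans d∣m (root ord-m))

coprime⇒order∣* : ∀ {m n r a b O} .{{_ : NonZero r}} → Coprime m n →
  IsOrder m r a → IsOrder n r b → IsOrder (m * n) r O → O ∣ a * b
coprime⇒order∣* {a = a} {b} c ord-m ord-n ord-mn = to (^≡1⇔order∣ ord-mn)
  (coprime-*-∣ c (from (^≡1⇔order∣ ord-m) (m∣m*n b)) (from (^≡1⇔order∣ ord-n) (n∣m*n a)))

%≡1⇒isOrder1 : ∀ {m r} .{{_ : NonZero m}} → r % m ≡ 1 % m → IsOrder m r 1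
%≡1⇒isOrder1 {m} {r} r%m≡1%m = record
  { root    = %≡⇒∣∸ (r ^ 1) 1 m (trans (cong (_% m) (*-identityʳ r)) r%m≡1%m)
  ; minimal = λ 0<k k<1 → contradiction (≤-pred k<1) (<⇒≱ 0<k)
  }

ordSearch-least : ∀ m r n k {i} → k ≤ i → i < n + k → r ^ i ≡1[mod m ] →
  k ≤ ordSearch m r n k × r ^ ordSearch m r n k ≡1[mod m ]
  × (∀ {j} → k ≤ j → j < ordSearch m r n k → ¬ r ^ j ≡1[mod m ])
ordSearch-least m r zero    k k≤i i<k _ = contradiction k≤i (<⇒≱ i<k)
ordSearch-least m r (suc n) k {i} k≤i i<1+n+k r^i≡1 with m ∣? (r ^ k ∸ 1)
... | yes r^k≡1 = ≤-refl , r^k≡1 , λ k≤j j<k → contradiction k≤j (<⇒≱ j<k)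
... | no  r^k≢1 with ordSearch-least m r n (suc k) k<i (subst (i <_) (sym (+-suc n k)) i<1+n+k) r^i≡1
  where
  k<i : k < i
  k<i = ≤∧≢⇒< k≤i λ { refl → r^k≢1 r^i≡1 }
...   | k<s , r^s≡1 , least = <⇒≤ k<s , r^s≡1 , λ k≤j j<s →
  [ (λ k<j → least k<j j<s) , (λ { refl → r^k≢1 }) ]′ (m≤n⇒m<n∨m≡n k≤j)

root≤m⇒ord-isOrder : ∀ {m r i} → 0 < i → i ≤ m → r ^ i ≡1[mod m ] → IsOrder m r (ord m r)
root≤m⇒ord-isOrder {m} {r} {i} 0<i i≤m r^i≡1
  with 0<o , r^o≡1 , least ← ordSearch-least m r m 1 0<i (subst (i <_) (+-comm 1 m) (s≤s i≤m)) r^i≡1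
  = record { nonZero = >-nonZero 0<o ; root = r^o≡1 ; minimal = least }

-- Two of r ^ 0, …, r ^ m agree modulo m, and r ^ a can be cancelled from their difference.
coprime⇒∃root≤m : ∀ {m r} .{{_ : NonZero m}} → Coprime r m → ∃[ i ] 0 < i × i ≤ m × r ^ i ≡1[mod m ]
coprime⇒∃root≤m {m@(suc _)} {r} c
  with a , b , a<b , r^a≡r^b ← pigeonhole (n<1+n m) (λ i → fromℕ< (m%n<n (r ^ toℕ i) m))
  = toℕ b ∸ toℕ a , m<n⇒0<n∸m a<b , ≤-trans (m∸n≤m (toℕ b) (toℕ a)) (toℕ≤pred[n] b) ,
    coprime-divisor-^ (toℕ a) (Coprime.sym c) m∣r^a*[r^[b-a]∸1]
  where
  r^a%m≡r^b%m : r ^ toℕ a % m ≡ r ^ toℕ b % m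
  r^a%m≡r^b%m = trans (sym (toℕ-fromℕ< _)) (trans (cong toℕ r^a≡r^b) (toℕ-fromℕ< _))
  m∣r^a*[r^[b-a]∸1] : m ∣ r ^ toℕ a * (r ^ (toℕ b ∸ toℕ a) ∸ 1)
  m∣r^a*[r^[b-a]∸1] = subst (m ∣_)
    (trans (cong (λ e → r ^ e ∸ r ^ toℕ a) (sym (m+[n∸m]≡n (<⇒≤ a<b)))) (m^[n+o]∸m^n≡m^n*[m^o∸1] r (toℕ a) _))
    (%≡⇒∣∸ (r ^ toℕ b) (r ^ toℕ a) m (sym r^a%m≡r^b%m))

coprime⇒ord-isOrder : ∀ {m r} .{{_ : NonZero m}} → Coprime r m → IsOrder m r (ord m r)
coprime⇒ord-isOrder c with _ , 0<i , i≤m , r^i≡1 ← coprime⇒∃root≤m c = root≤m⇒ord-isOrder 0<i i≤m r^i≡1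

ord[1,r]≡1 : ∀ r → ord 1 r ≡ 1
ord[1,r]≡1 r = ≤-antisym (≮⇒≥ λ 1<o → minimal ord₁ z<s 1<o (1∣ _)) (>-nonZero⁻¹ _ {{nonZero ord₁}})
  where ord₁ = root≤m⇒ord-isOrder {1} {r} z<s ≤-refl (1∣ _)

κ[1,r,t]≡1 : ∀ r t → κ 1 r t ≡ 1
κ[1,r,t]≡1 r t rewrite ord[1,r]≡1 r | gcd-zeroˡ (t * S 1 r) = refl

gcd[x,m*n]≡1⇔ : ∀ {m n x} → Prime m → Prime n → gcd x (m * n) ≡ 1 ⇔ (¬ m ∣ x × ¬ n ∣ x)
gcd[x,m*n]≡1⇔ pm pn = mk⇔
  (λ g → let cm , cn = to coprime-*⇔ (gcd≡1⇒coprime g) in to (coprime⇔∤ pm) cm , to (coprime⇔∤ pn) cn)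
  (λ (m∤x , n∤x) → coprime⇒gcd≡1 (from coprime-*⇔ (from (coprime⇔∤ pm) m∤x , from (coprime⇔∤ pn) n∤x)))

prime[3] : Prime 3
prime[3] = from-yes (prime? 3)

Λ[1,r,t]⇔ : ∀ {p r t ℓ} → Prime p →
  Λ p 1 r t ℓ ⇔ (0 < ℓ × ℓ ∣ ord (3 * p) r × ¬ r ^ ℓ ≡1[mod 3 ] × ¬ r ^ ℓ ≡1[mod p ])
Λ[1,r,t]⇔ {p} {r} {t} {ℓ} pp
  rewrite κ[1,r,t]≡1 r t | gcd-zeroˡ (ord (3 * p) r) | n/1≡n (ord (3 * p) r) | *-identityʳ ℓ = mk⇔
  (λ (0<ℓ , ℓ∣O , g) → 0<ℓ , ℓ∣O , to (gcd[x,m*n]≡1⇔ prime[3] pp) g)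
  (λ (0<ℓ , ℓ∣O , 3∤ , p∤) → 0<ℓ , ℓ∣O , from (gcd[x,m*n]≡1⇔ prime[3] pp) (3∤ , p∤))

%3≡2⇒isOrder2 : ∀ {r} .{{_ : NonZero r}} → r % 3 ≡ 2 → IsOrder 3 r 2
%3≡2⇒isOrder2 {r} r%3≡2 = record
  { root    = %≡⇒∣∸ (r ^ 2) 1 3 r^2%3≡1
  ; minimal = λ { {suc zero} _ _ 3∣r∸1 → 2≢1 (trans (sym r^1%3≡2) (∣∸⇒%≡ (r ^ 1) 1 3 (m^n>0 r 1) 3∣r∸1))
                ; {suc (suc _)} _ (s≤s (s≤s ())) }
  }
  where
  open ≡-Reasoning
  2≢1 : 2 ≢ 1
  2≢1 ()
  r^1%3≡2 : r ^ 1 % 3 ≡ 2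
  r^1%3≡2 = trans (cong (_% 3) (*-identityʳ r)) r%3≡2
  r^2%3≡1 : r ^ 2 % 3 ≡ 1
  r^2%3≡1 = begin
    r * (r * 1) % 3         ≡⟨ cong (λ x → r * x % 3) (*-identityʳ r) ⟩
    r * r % 3               ≡⟨ %-distribˡ-* r r 3 ⟩
    (r % 3) * (r % 3) % 3   ≡⟨ cong (λ x → x * x % 3) r%3≡2 ⟩
    1                       ∎

nonRoot-divisors⇔odd-proper-divisors : ∀ {m n r o O ℓ} .{{_ : NonZero r}} → Coprime m n →
  IsOrder m r 2 → IsOrder n r o → IsOrder (m * n) r O →
  (0 < ℓ × ℓ ∣ O × ¬ r ^ ℓ ≡1[mod m ] × ¬ r ^ ℓ ≡1[mod n ]) ⇔ (Δ o ℓ × ℓ % 2 ≡ 1)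
nonRoot-divisors⇔odd-proper-divisors {m} {n} {r} {o} {O} {ℓ} c ord-m ord-n ord-mn = mk⇔
  (λ (0<ℓ , ℓ∣O , m∤ , n∤) →
    let 2∤ℓ = m∤ ∘ from (^≡1⇔order∣ ord-m)
        ℓ∣o = coprime-divisor (from (coprime⇔∤ prime[2]) 2∤ℓ) (∣-trans ℓ∣O O∣2*o)
        ℓ≢o = λ { refl → n∤ (root ord-n) }
    in (0<ℓ , ≤∧≢⇒< (∣⇒≤ ℓ∣o) ℓ≢o , ℓ∣o) , to ¬2∣⇔%2≡1 2∤ℓ)
  (λ ((0<ℓ , ℓ<o , ℓ∣o) , ℓ%2≡1) →
    0<ℓ , ∣-trans ℓ∣o o∣O , from (¬2∣⇔%2≡1 {ℓ}) ℓ%2≡1 ∘ to (^≡1⇔order∣ ord-m) , minimal ord-n 0<ℓ ℓ<o)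
  where
  instance _ = nonZero ord-n
  o∣O : o ∣ O
  o∣O = ∣⇒order∣order (n∣m*n m) ord-n ord-mn
  O∣2*o : O ∣ 2 * o
  O∣2*o = coprime⇒order∣* c ord-m ord-n ord-mn

-- Neither the choice of t nor the bound r ≤ 3p − 1 matters: κ(1,r,t) = 1 for every t.
lemma5p2 : (p t r : ℕ) → Prime p → 3 < p
    → (t ≡ 1 ⊎ t ≡ 3 ⊎ t ≡ p ⊎ t ≡ 3 * p)
    → 1 ≤ r → r ≤ 3 * p ∸ 1 → gcd r (3 * p) ≡ 1
    → (r % 3 ≡ 1 → (ℓ : ℕ) → Λ p 1 r t ℓ → ⊥)
      × (r % 3 ≡ 2 → (ℓ : ℕ) → Λ p 1 r t ℓ ⇔ (Δ (ord p r) ℓ × ℓ % 2 ≡ 1))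
lemma5p2 p t r pp 3<p _ 0<r _ gcd[r,3p]≡1 = Λ-empty , Λ-odd
  where
  instance
    _ = >-nonZero 0<r
    _ = prime⇒nonZero pp
  coprime[r,3p] : Coprime r (3 * p)
  coprime[r,3p] = gcd≡1⇒coprime gcd[r,3p]≡1
  ord₃ₚ : IsOrder (3 * p) r (ord (3 * p) r)
  ord₃ₚ = coprime⇒ord-isOrder {{m*n≢0 3 p}} coprime[r,3p]
  ordₚ : IsOrder p r (ord p r)
  ordₚ = coprime⇒ord-isOrder (proj₂ (to (coprime-*⇔ {r} {3}) coprime[r,3p]))

  Λ-empty : r % 3 ≡ 1 → ∀ ℓ → Λ p 1 r t ℓ → ⊥
  Λ-empty r%3≡1 ℓ Λℓ with _ , _ , 3∤ , _ ← to (Λ[1,r,t]⇔ {t = t} pp) Λℓ =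
    3∤ (from (^≡1⇔order∣ (%≡1⇒isOrder1 r%3≡1)) (1∣ ℓ))

  Λ-odd : r % 3 ≡ 2 → ∀ ℓ → Λ p 1 r t ℓ ⇔ (Δ (ord p r) ℓ × ℓ % 2 ≡ 1)
  Λ-odd r%3≡2 ℓ = nonRoot-divisors⇔odd-proper-divisors
    (Coprime.sym (prime⇒coprime pp 3<p)) (%3≡2⇒isOrder2 r%3≡2) ordₚ ord₃ₚ ⇔-∘ Λ[1,r,t]⇔ {t = t} pp
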